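{- Let $m\ge 1$ and let $M\in\Lambda_{2m}^m$ satisfy $M_{i,1}=1$ and $M_{1,j}=1$ for all $1\le i,j\le m$. Let $R_1=C_1=\{1\}$, $R_2=C_2=\{2,\dots,m\}$, $R_3=C_3=\{m+1,\dots,2m\}$, and let $M_{a,b}$ denote the set of cells $R_a\times C_b$. Then there exists a critical set $K$ of $M$ such that: $K$ contains no triple whose cell lies in $M_{1,1}\cup M_{1,2}\cup M_{1,3}\cup M_{2,1}\cup M_{3,1}$; $K$ contains every triple $(i,j,1)\in M$ with $(i,j)\in M_{3,3}\cup M_{2,3}\cup M_{3,2}$; and $K$ contains no triple $(i,j,0)$ with $(i,j)\in M_{2,2}\cup M_{2,3}\cup M_{3,2}\cup M_{3,3}$.
   Context: $\Lambda_{n}^{x}$ is the set of $n\times n$ $(0,1)$-matrices with every row sum and every column sum equal to $x$. A matrix $M$ is identified with the set of triples $\{(i,j,M_{ij})\}$. A subset $D\subseteq M$ is a defining set for $M$ if $M$ is the unique element of $\Lambda_{2m}^m$ containing $D$; a critical set is a defining set none of whose proper subsets is a defining set. -}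

module Defs where

open import Data.Bool using (Bool; true; false; if_then_else_)
open import Data.Nat using (ℕ; _≤_; _<_)
open import Data.Fin using (Fin; toℕ)
open import Data.List using (map; allFin)
open import Data.Nat.ListAction using (sum)
open import Data.Product using (Σ; ∃; _×_)
open import Relation.Binary.PropositionalEquality using (_≡_)
open import Relation.Nullary using (¬_)

-- An n×n (0,1)-matrix; true = 1, false = 0.  Indices are 0-based.
Mat : ℕ → Set
Mat n = Fin n → Fin n → Bool

bit : Bool → ℕ
bit b = if b then 1 else 0

rowSum : ∀ {n} → Mat n → Fin n → ℕ
rowSum {n} M i = sum (map (λ j → bit (M i j)) (allFin n))

colSum : ∀ {n} → Mat n → Fin n → ℕ
colSum {n} M j = sum (map (λ i → bit (M i j)) (allFin n))

InΛ : (n x : ℕ) → Mat n → Set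
InΛ n x M = (∀ i → rowSum M i ≡ x) × (∀ j → colSum M j ≡ x)

-- A subset of the triples {(i,j,M i j)} of M is determined by the set of
-- cells it uses; we represent it as a Boolean cell-indicator.
CellSet : ℕ → Set
CellSet n = Fin n → Fin n → Bool

IsDefining : (n x : ℕ) → Mat n → CellSet n → Set
IsDefining n x M D =
  InΛ n x M ×
  ((N : Mat n) → InΛ n x N →
     (∀ i j → D i j ≡ true → N i j ≡ M i j) →
     ∀ i j → N i j ≡ M i j)

_⊆ᶜ_ : ∀ {n} → CellSet n → CellSet n → Set
D' ⊆ᶜ D = ∀ i j → D' i j ≡ true → D i j ≡ true

_⊂ᶜ_ : ∀ {n} → CellSet n → CellSet n → Set
D' ⊂ᶜ D = D' ⊆ᶜ D × ∃ λ i → ∃ λ j → D i j ≡ true × D' i j ≡ false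

IsCritical : (n x : ℕ) → Mat n → CellSet n → Set
IsCritical n x M K =
  IsDefining n x M K × ((K' : CellSet n) → K' ⊂ᶜ K → ¬ IsDefining n x M K')

module Submission where

-- Counting ('weight-squeeze') makes row 0 and column 0 the indicators of
-- their first m positions, and then the 1s outside row 0 and column 0 form a
-- defining set ('interior-defining').  Being defining is decidable, so a
-- critical subset K of it exists by greedy pruning ('critical-subset'); such
-- K avoids row 0, column 0 and all 0s.  Every defining set meets every switch
-- (alternating 2×2 submatrix), because complementing a switch stays in Λ
-- ('switch-forces'); for a 1 at (i, j) with i ≥ 1, j ≥ m the switch on rows
-- i, 0 and columns j, c (with M i c = 0, c < m) has its other cells outside
-- K, so (i, j) ∈ K ('far-column-forced'; rows i ≥ m by transposition).

open import Defs
open import Data.Bool using (Bool; true; false; not; _∧_; _∨_; _xor_; if_then_else_)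
open import Data.Bool.Properties using (∧-identityʳ; ∧-zeroʳ; not-involutive; not-¬)
  renaming (_≟_ to _≟ᵇ_)
open import Data.Nat using (ℕ; zero; suc; _+_; _≤_; _<_; z≤n; s≤s) renaming (_≟_ to _≟ⁿ_)
open import Data.Nat.Properties
  using (_<?_; ≮⇒≥; suc-injective; +-comm; +-assoc; +-cancelʳ-≡; +-mono-≤;
         ≤-refl; ≤-reflexive; ≤⇒≯; m≤m+n)
open import Data.Fin using (Fin; zero; suc; toℕ)
open import Data.Fin.Properties using (_≟_; any?; all?)
open import Data.List using (List; []; _∷_; map; allFin; tabulate; cartesianProduct)
open import Data.List.Properties using (map-tabulate; tabulate-cong)
open import Data.List.Membership.Propositional using (_∈_)
open import Data.List.Membership.Propositional.Properties using (∈-cartesianProduct⁺; ∈-allFin)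
open import Data.List.Relation.Unary.Any using (here; there)
open import Data.Nat.ListAction using (sum)
open import Data.Vec using (Vec; []; _∷_; lookup)
  renaming (tabulate to tabulateᵛ)
open import Data.Vec.Properties using (lookup∘tabulate)
open import Data.Product using (Σ; ∃; _×_; _,_; proj₁; proj₂)
open import Data.Sum using (_⊎_; inj₁; inj₂)
open import Data.Empty using (⊥-elim)
open import Function using (id; _∘_)
open import Relation.Nullary using (¬_; Dec; yes; no; does)
open import Relation.Nullary.Decidable using (dec-true; dec-false; map′; _×-dec_; _→-dec_)
open import Relation.Binary.PropositionalEquality
  using (_≡_; _≢_; _≗_; refl; sym; trans; cong; cong₂; module ≡-Reasoning)

private
  variable
    n x : ℕ

true≢false : true ≢ false
true≢false ()

∧-split : {a b : Bool} → a ∧ b ≡ true → a ≡ true × b ≡ true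
∧-split {true} {true} _ = refl , refl

does-sound : ∀ {A : Set} (a? : Dec A) → does a? ≡ true → A
does-sound (yes a) _ = a

weight : (Fin n → Bool) → ℕ
weight f = sum (tabulate (λ k → bit (f k)))

sum-weight : (f : Fin n → Bool) → sum (map (λ k → bit (f k)) (allFin n)) ≡ weight f
sum-weight f = cong sum (map-tabulate id (λ k → bit (f k)))

row-weight : ∀ {M : Mat n} → InΛ n x M → ∀ i → weight (M i) ≡ x
row-weight {M = M} (rows , _) i = trans (sym (sum-weight (M i))) (rows i)

col-weight : ∀ {M : Mat n} → InΛ n x M → ∀ j → weight (λ i → M i j) ≡ x
col-weight {M = M} (_ , cols) j = trans (sym (sum-weight (λ i → M i j))) (cols j)

InΛ-from-weights : ∀ {M : Mat n} → (∀ i → weight (M i) ≡ x) →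
                   (∀ j → weight (λ i → M i j) ≡ x) → InΛ n x M
InΛ-from-weights {M = M} rows cols =
  (λ i → trans (sum-weight (M i)) (rows i)) ,
  (λ j → trans (sum-weight (λ i → M i j)) (cols j))

weight-cong : {f g : Fin n → Bool} → f ≗ g → weight f ≡ weight g
weight-cong f≗g = cong sum (tabulate-cong (cong bit ∘ f≗g))

_⊑_ : (f g : Fin n → Bool) → Set
f ⊑ g = ∀ k → f k ≡ true → g k ≡ true

bit-mono : {a b : Bool} → (a ≡ true → b ≡ true) → bit a ≤ bit b
bit-mono {false} _ = z≤n
bit-mono {true} a⇒b with refl ← a⇒b refl = ≤-refl

weight-mono : {f g : Fin n → Bool} → f ⊑ g → weight f ≤ weight g
weight-mono {zero} _ = z≤n
weight-mono {suc n} f⊑g = +-mono-≤ (bit-mono (f⊑g zero)) (weight-mono (f⊑g ∘ suc))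

weight-squeeze : {f g : Fin n → Bool} → f ⊑ g → weight f ≡ weight g → f ≗ g
weight-squeeze {suc n} {f} {g} f⊑g w with f zero in f₀ | g zero in g₀
... | true | true = λ where
  zero → trans f₀ (sym g₀)
  (suc k) → weight-squeeze (f⊑g ∘ suc) (suc-injective w) k
... | false | false = λ where
  zero → trans f₀ (sym g₀)
  (suc k) → weight-squeeze (f⊑g ∘ suc) w k
... | true | false = ⊥-elim (true≢false (trans (sym (f⊑g zero f₀)) g₀))
... | false | true = ⊥-elim (≤⇒≯ (weight-mono (f⊑g ∘ suc)) (≤-reflexive (sym w)))

lead : ℕ → Fin n → Bool
lead m k = does (toℕ k <? m)

module _ {m : ℕ} where

  lead-sound : {k : Fin n} → lead m k ≡ true → toℕ k < m
  lead-sound {k = k} = does-sound (toℕ k <? m)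

  lead-true : {k : Fin n} → toℕ k < m → lead m k ≡ true
  lead-true {k = k} = dec-true (toℕ k <? m)

  lead-false : {k : Fin n} → m ≤ toℕ k → lead m k ≡ false
  lead-false {k = k} m≤k = dec-false (toℕ k <? m) (≤⇒≯ m≤k)

weight-lead : ∀ {m} → m ≤ n → weight (lead {n} m) ≡ m
weight-lead {zero} {zero} _ = refl
weight-lead {suc n} {zero} _ = weight-lead {n} {zero} z≤n
weight-lead {suc n} {suc m} (s≤s m≤n) = cong suc (weight-lead m≤n)

module _ {m : ℕ} (m≤n : m ≤ n) {f : Fin n → Bool} (w : weight f ≡ m) where

  lead-⊑-exact : lead m ⊑ f → f ≗ lead m
  lead-⊑-exact lead⊑f k = sym (weight-squeeze lead⊑f (trans (weight-lead m≤n) (sym w)) k)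

  ⊑-lead-exact : f ⊑ lead m → f ≗ lead m
  ⊑-lead-exact f⊑lead = weight-squeeze f⊑lead (trans w (sym (weight-lead m≤n)))

  lead-gap : ∀ {j} → m ≤ toℕ j → f j ≡ true → ∃ λ k → toℕ k < m × f k ≡ false
  lead-gap {j} m≤j fj with any? (λ k → (toℕ k <? m) ×-dec (f k ≟ᵇ false))
  ... | yes gap = gap
  ... | no no-gap =
    ⊥-elim (true≢false (trans (sym fj) (trans (lead-⊑-exact lead⊑f j) (lead-false m≤j))))
    where
    lead⊑f : lead m ⊑ f
    lead⊑f k k<m with f k in fk
    ... | true = refl
    ... | false = ⊥-elim (no-gap (k , lead-sound k<m , fk))

toggle : Fin n → (Fin n → Bool) → Fin n → Bool
toggle a f c = does (c ≟ a) xor f c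

swap-ends : ∀ a w b → a + w + b ≡ b + w + a
swap-ends a w b = begin
  a + w + b     ≡⟨ +-comm (a + w) b ⟩
  b + (a + w)   ≡⟨ cong (b +_) (+-comm a w) ⟩
  b + (w + a)   ≡⟨ sym (+-assoc b w a) ⟩
  b + w + a     ∎
  where open ≡-Reasoning

weight-toggle : (a : Fin n) (f : Fin n → Bool) →
                weight (toggle a f) + bit (f a) ≡ weight f + bit (not (f a))
weight-toggle zero f = swap-ends (bit (not (f zero))) (weight (f ∘ suc)) (bit (f zero))
weight-toggle (suc a) f = begin
  bit (f zero) + weight (toggle a (f ∘ suc)) + bit (f (suc a))
    ≡⟨ +-assoc (bit (f zero)) _ _ ⟩
  bit (f zero) + (weight (toggle a (f ∘ suc)) + bit (f (suc a)))
    ≡⟨ cong (bit (f zero) +_) (weight-toggle a (f ∘ suc)) ⟩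
  bit (f zero) + (weight (f ∘ suc) + bit (not (f (suc a))))
    ≡⟨ sym (+-assoc (bit (f zero)) _ _) ⟩
  bit (f zero) + weight (f ∘ suc) + bit (not (f (suc a)))  ∎
  where open ≡-Reasoning

isOneOf : Fin n → Fin n → Fin n → Bool
isOneOf a b c = does (c ≟ a) ∨ does (c ≟ b)

isOneOf-sound : (a b c : Fin n) → isOneOf a b c ≡ true → c ≡ a ⊎ c ≡ b
isOneOf-sound a b c e with c ≟ a | c ≟ b
... | yes c≡a | _ = inj₁ c≡a
... | no _ | yes c≡b = inj₂ c≡b

toggle-twice : {a b : Fin n} → a ≢ b → (f : Fin n → Bool) →
               (λ c → isOneOf a b c xor f c) ≗ toggle b (toggle a f)
toggle-twice {a = a} {b} a≢b f c with c ≟ a | c ≟ b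
... | yes refl | yes refl = ⊥-elim (a≢b refl)
... | yes _ | no _ = refl
... | no _ | yes _ = refl
... | no _ | no _ = refl

weight-toggle₂ : ∀ {n} {a b : Fin n} → a ≢ b → {f : Fin n → Bool} → f a ≡ not (f b) →
                 weight (λ c → isOneOf a b c xor f c) ≡ weight f
weight-toggle₂ {n} {a} {b} a≢b {f} fa = +-cancelʳ-≡ (bit (f b)) _ _ (begin
  weight (λ c → isOneOf a b c xor f c) + bit (f b)
    ≡⟨ cong (_+ bit (f b)) (weight-cong (toggle-twice a≢b f)) ⟩
  weight (toggle b g) + bit (f b)     ≡⟨ cong (λ y → weight (toggle b g) + bit y) (sym gb) ⟩
  weight (toggle b g) + bit (g b)     ≡⟨ weight-toggle b g ⟩
  weight g + bit (not (g b))          ≡⟨ cong (λ y → weight g + bit (not y)) gb ⟩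
  weight g + bit (not (f b))          ≡⟨ cong (λ y → weight g + bit y) (sym fa) ⟩
  weight g + bit (f a)                ≡⟨ weight-toggle a f ⟩
  weight f + bit (not (f a))          ≡⟨ cong (λ y → weight f + bit (not y)) fa ⟩
  weight f + bit (not (not (f b)))    ≡⟨ cong (λ y → weight f + bit y) (not-involutive (f b)) ⟩
  weight f + bit (f b)                ∎)
  where
  open ≡-Reasoning
  g : Fin n → Bool
  g = toggle a f
  gb : g b ≡ f b
  gb = cong (_xor f b) (dec-false (b ≟ a) (a≢b ∘ sym))

⊆-trans : {A B C : CellSet n} → A ⊆ᶜ B → B ⊆ᶜ C → A ⊆ᶜ C
⊆-trans A⊆B B⊆C i j = B⊆C i j ∘ A⊆B i j

⊆-false : {A B : CellSet n} → A ⊆ᶜ B → ∀ {i j} → B i j ≡ false → A i j ≡ false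
⊆-false {A = A} A⊆B {i} {j} Bij with A i j in Aij
... | false = refl
... | true = ⊥-elim (true≢false (trans (sym (A⊆B i j Aij)) Bij))

tr : Mat n → Mat n
tr M i j = M j i

tr-Λ : {M : Mat n} → InΛ n x M → InΛ n x (tr M)
tr-Λ (rows , cols) = cols , rows

tr-defining : {M : Mat n} {D : CellSet n} → IsDefining n x M D → IsDefining n x (tr M) (tr D)
tr-defining (ΛM , unique) =
  tr-Λ ΛM , λ N ΛN agree i j → unique (tr N) (tr-Λ ΛN) (λ a b → agree b a) j i

record Switch (M : Mat n) : Set where
  field
    r₁ r₂ c₁ c₂ : Fin n
    r₁≢r₂ : r₁ ≢ r₂
    c₁≢c₂ : c₁ ≢ c₂
    M₁₁ : M r₁ c₁ ≡ true
    M₁₂ : M r₁ c₂ ≡ false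
    M₂₁ : M r₂ c₁ ≡ false
    M₂₂ : M r₂ c₂ ≡ true

  inRectangle : Fin n → Fin n → Bool
  inRectangle r c = isOneOf r₁ r₂ r ∧ isOneOf c₁ c₂ c

  switched : Mat n
  switched r c = inRectangle r c xor M r c

module _ {n} {M : Mat n} (s : Switch M) where
  open Switch s

  private
    row-alternates : ∀ r → isOneOf r₁ r₂ r ≡ true → M r c₁ ≡ not (M r c₂)
    row-alternates r e with isOneOf-sound r₁ r₂ r e
    ... | inj₁ refl = trans M₁₁ (cong not (sym M₁₂))
    ... | inj₂ refl = trans M₂₁ (cong not (sym M₂₂))

    col-alternates : ∀ c → isOneOf c₁ c₂ c ≡ true → M r₁ c ≡ not (M r₂ c)
    col-alternates c e with isOneOf-sound c₁ c₂ c e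
    ... | inj₁ refl = trans M₁₁ (cong not (sym M₂₁))
    ... | inj₂ refl = trans M₁₂ (cong not (sym M₂₂))

  switched-Λ : ∀ {x} → InΛ n x M → InΛ n x switched
  switched-Λ {x} ΛM = InΛ-from-weights rows cols
    where
    rows : ∀ r → weight (λ c → (isOneOf r₁ r₂ r ∧ isOneOf c₁ c₂ c) xor M r c) ≡ x
    rows r with isOneOf r₁ r₂ r in e
    ... | true = trans (weight-toggle₂ c₁≢c₂ (row-alternates r e)) (row-weight ΛM r)
    ... | false = row-weight ΛM r
    cols : ∀ c → weight (λ r → (isOneOf r₁ r₂ r ∧ isOneOf c₁ c₂ c) xor M r c) ≡ x
    cols c with isOneOf c₁ c₂ c in e
    ... | true = trans (weight-cong (λ r → cong (_xor M r c) (∧-identityʳ (isOneOf r₁ r₂ r))))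
                       (trans (weight-toggle₂ r₁≢r₂ (col-alternates c e)) (col-weight ΛM c))
    ... | false = trans (weight-cong (λ r → cong (_xor M r c) (∧-zeroʳ (isOneOf r₁ r₂ r)))) (col-weight ΛM c)

  -- Every defining set meets every switch: avoiding three of its cells
  -- forces the fourth, since otherwise D also lies in the switched matrix,
  -- a second member of Λ differing from M at (r₁, c₁).
  switch-forces : ∀ {x} {D : CellSet n} → IsDefining n x M D →
                  D r₁ c₂ ≡ false → D r₂ c₁ ≡ false → D r₂ c₂ ≡ false → D r₁ c₁ ≡ true
  switch-forces {D = D} (ΛM , unique) d₁₂ d₂₁ d₂₂ with D r₁ c₁ in d₁₁
  ... | true = refl
  ... | false = ⊥-elim (not-¬ refl (sym (trans (sym corner) (unique switched (switched-Λ ΛM) agree r₁ c₁))))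
    where
    avoided : ∀ r c → inRectangle r c ≡ true → D r c ≡ false
    avoided r c e
      with isOneOf-sound r₁ r₂ r (proj₁ (∧-split e)) | isOneOf-sound c₁ c₂ c (proj₂ (∧-split e))
    ... | inj₁ refl | inj₁ refl = d₁₁
    ... | inj₁ refl | inj₂ refl = d₁₂
    ... | inj₂ refl | inj₁ refl = d₂₁
    ... | inj₂ refl | inj₂ refl = d₂₂
    agree : ∀ r c → D r c ≡ true → inRectangle r c xor M r c ≡ M r c
    agree r c Drc with inRectangle r c in e
    ... | false = refl
    ... | true = ⊥-elim (true≢false (trans (sym Drc) (avoided r c e)))
    corner : switched r₁ c₁ ≡ not (M r₁ c₁)
    corner = cong (_xor M r₁ c₁)
      (cong₂ _∧_ (cong (_∨ does (r₁ ≟ r₂)) (dec-true (r₁ ≟ r₁) refl))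
                 (cong (_∨ does (c₁ ≟ c₂)) (dec-true (c₁ ≟ c₁) refl)))

_≐_ : Mat n → Mat n → Set
M ≐ N = ∀ i j → M i j ≡ N i j

InΛ-resp : {M N : Mat n} → M ≐ N → InΛ n x M → InΛ n x N
InΛ-resp M≐N ΛM = InΛ-from-weights
  (λ i → trans (sym (weight-cong (M≐N i))) (row-weight ΛM i))
  (λ j → trans (sym (weight-cong (λ i → M≐N i j))) (col-weight ΛM j))

InΛ? : ∀ n x (M : Mat n) → Dec (InΛ n x M)
InΛ? n x M = all? (λ i → rowSum M i ≟ⁿ x) ×-dec all? (λ j → colSum M j ≟ⁿ x)

Searchable : Set → Set₁
Searchable A = (P : A → Set) → (∀ a → Dec (P a)) → Dec (∀ a → P a)

searchBool : Searchable Bool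
searchBool P P? with P? true | P? false
... | yes pt | yes pf = yes λ { true → pt ; false → pf }
... | no ¬pt | _ = no λ all → ¬pt (all true)
... | yes _ | no ¬pf = no λ all → ¬pf (all false)

searchVec : ∀ {A} → Searchable A → ∀ k → Searchable (Vec A k)
searchVec searchA zero P P? = map′ (λ { p [] → p }) (λ all → all []) (P? [])
searchVec searchA (suc k) P P? =
  map′ (λ { all (a ∷ v) → all a v }) (λ all a v → all (a ∷ v))
       (searchA (λ a → ∀ v → P (a ∷ v))
                (λ a → searchVec searchA k (λ v → P (a ∷ v)) (λ v → P? (a ∷ v))))

-- Matrices are searchable for properties invariant under pointwise equality,
-- because every matrix is pointwise equal to one read off a table of vectors.
searchMat : ∀ n (P : Mat n → Set) → (∀ {M N} → M ≐ N → P M → P N) →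
            (∀ M → Dec (P M)) → Dec (∀ M → P M)
searchMat n P resp P? =
  map′ (λ all M → resp (entries-table M) (all (table M))) (λ all V → all (entries V))
       (searchVec (searchVec searchBool n) n (P ∘ entries) (P? ∘ entries))
  where
  entries : Vec (Vec Bool n) n → Mat n
  entries V i j = lookup (lookup V i) j
  table : Mat n → Vec (Vec Bool n) n
  table M = tabulateᵛ (λ i → tabulateᵛ (M i))
  entries-table : ∀ M → entries (table M) ≐ M
  entries-table M i j =
    trans (cong (λ v → lookup v j) (lookup∘tabulate _ i)) (lookup∘tabulate (M i) j)

-- Being defining is decidable: the uniqueness clause quantifies over the
-- finitely many matrices of size n.
IsDefining? : ∀ n x (M : Mat n) (D : CellSet n) → Dec (IsDefining n x M D)
IsDefining? n x M D = InΛ? n x M ×-dec searchMat n Unique resp Unique?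
  where
  Unique : Mat n → Set
  Unique N = InΛ n x N → (∀ i j → D i j ≡ true → N i j ≡ M i j) → ∀ i j → N i j ≡ M i j
  resp : ∀ {N N′} → N ≐ N′ → Unique N → Unique N′
  resp N≐N′ unique ΛN′ agree i j =
    trans (sym (N≐N′ i j))
          (unique (InΛ-resp (λ a b → sym (N≐N′ a b)) ΛN′) (λ a b d → trans (N≐N′ a b) (agree a b d)) i j)
  Unique? : ∀ N → Dec (Unique N)
  Unique? N = InΛ? n x N
    →-dec all? (λ i → all? (λ j → (D i j ≟ᵇ true) →-dec (N i j ≟ᵇ M i j)))
    →-dec all? (λ i → all? (λ j → N i j ≟ᵇ M i j))

defining-mono : {M : Mat n} {D D′ : CellSet n} → D ⊆ᶜ D′ → IsDefining n x M D → IsDefining n x M D′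
defining-mono D⊆D′ (ΛM , unique) = ΛM , λ N ΛN agree → unique N ΛN (λ i j → agree i j ∘ D⊆D′ i j)

remove : CellSet n → Fin n × Fin n → CellSet n
remove D (a , b) i j = if does (i ≟ a) ∧ does (j ≟ b) then false else D i j

remove-⊆ : (D : CellSet n) (c : Fin n × Fin n) → remove D c ⊆ᶜ D
remove-⊆ D (a , b) i j e with does (i ≟ a) ∧ does (j ≟ b)
... | true = ⊥-elim (true≢false (sym e))
... | false = e

remove-mono : {K D : CellSet n} → K ⊆ᶜ D → (c : Fin n × Fin n) → remove K c ⊆ᶜ remove D c
remove-mono K⊆D (a , b) i j e with does (i ≟ a) ∧ does (j ≟ b)
... | true = e
... | false = K⊆D i j e

remove-at : (D : CellSet n) (a b : Fin n) → remove D (a , b) a b ≡ false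
remove-at D a b rewrite dec-true (a ≟ a) refl | dec-true (b ≟ b) refl = refl

⊆-remove : {K K′ : CellSet n} → K′ ⊆ᶜ K → ∀ {i j} → K′ i j ≡ false → K′ ⊆ᶜ remove K (i , j)
⊆-remove K′⊆K {i} {j} K′ij r c e with r ≟ i | c ≟ j
... | yes refl | yes refl = ⊥-elim (true≢false (trans (sym e) K′ij))
... | yes _ | no _ = K′⊆K r c e
... | no _ | _ = K′⊆K r c e

module Minimal {n} (P : CellSet n → Set) (P? : ∀ D → Dec (P D))
               (P-mono : ∀ {D D′} → D ⊆ᶜ D′ → P D → P D′) where

  Cell : Set
  Cell = Fin n × Fin n

  MinimalAt : List Cell → CellSet n → Set
  MinimalAt cs K = ∀ c → c ∈ cs → K (proj₁ c) (proj₂ c) ≡ true → ¬ P (remove K c)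

  prune : ∀ cs D → P D → Σ (CellSet n) λ K → K ⊆ᶜ D × P K × MinimalAt cs K
  prune [] D pD = D , (λ _ _ e → e) , pD , λ _ ()
  prune (c ∷ cs) D pD with P? (remove D c)
  ... | yes pD⁻ with prune cs (remove D c) pD⁻
  ...   | K , K⊆D⁻ , pK , minimal = K , ⊆-trans K⊆D⁻ (remove-⊆ D c) , pK , minimal′
    where
    -- the cell c was removed, so it does not lie in K
    minimal′ : MinimalAt (c ∷ cs) K
    minimal′ _ (here refl) Kc =
      ⊥-elim (true≢false (trans (sym (K⊆D⁻ _ _ Kc)) (remove-at D (proj₁ c) (proj₂ c))))
    minimal′ c′ (there c′∈cs) = minimal c′ c′∈cs
  prune (c ∷ cs) D pD | no ¬pD⁻ with prune cs D pD
  ... | K , K⊆D , pK , minimal = K , K⊆D , pK , minimal′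
    where
    -- removing c from K would remove it from D as well
    minimal′ : MinimalAt (c ∷ cs) K
    minimal′ _ (here refl) _ pK⁻ = ¬pD⁻ (P-mono (remove-mono K⊆D c) pK⁻)
    minimal′ c′ (there c′∈cs) = minimal c′ c′∈cs

  minimal-subset : ∀ D → P D → Σ (CellSet n) λ K → K ⊆ᶜ D × P K × (∀ K′ → K′ ⊂ᶜ K → ¬ P K′)
  minimal-subset D pD with prune (cartesianProduct (allFin n) (allFin n)) D pD
  ... | K , K⊆D , pK , minimal = K , K⊆D , pK , λ where
    K′ (K′⊆K , i , j , Kij , K′ij) pK′ →
      minimal (i , j) (∈-cartesianProduct⁺ (∈-allFin i) (∈-allFin j)) Kij
              (P-mono (⊆-remove K′⊆K K′ij) pK′)

critical-subset : {M : Mat n} {D : CellSet n} → IsDefining n x M D →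
                  Σ (CellSet n) λ K → K ⊆ᶜ D × IsCritical n x M K
critical-subset {n} {x} {M} {D} dD =
  Minimal.minimal-subset (IsDefining n x M) (IsDefining? n x M) defining-mono D dD

-- Throughout, m = k + 1 and the matrices have size 2m, so that row and
-- column 0 exist and can be matched on.
module LeadLines (k : ℕ) where

  m : ℕ
  m = suc k

  size : ℕ
  size = m + m

  m≤size : m ≤ size
  m≤size = m≤m+n m m

  LeadCol : Mat size → Set
  LeadCol M = ∀ i → toℕ i < m → M i zero ≡ true

  lead-col : {M : Mat size} → InΛ size m M → LeadCol M → ∀ i → M i zero ≡ lead m i
  lead-col ΛM leadM = lead-⊑-exact m≤size (col-weight ΛM zero) (λ i e → leadM i (lead-sound e))

  interior : Mat size → CellSet size
  interior M zero _ = false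
  interior M (suc _) zero = false
  interior M (suc i) (suc j) = M (suc i) (suc j)

  interior-⊆ : (M : Mat size) → interior M ⊆ᶜ M
  interior-⊆ M (suc i) (suc j) e = e

  interior-tr : (M : Mat size) → ∀ i j → interior (tr M) i j ≡ interior M j i
  interior-tr M zero zero = refl
  interior-tr M zero (suc j) = refl
  interior-tr M (suc i) zero = refl
  interior-tr M (suc i) (suc j) = refl

  interior-lead : (M : Mat size) → ∀ i j → toℕ i ≡ 0 ⊎ toℕ j ≡ 0 → interior M i j ≡ false
  interior-lead M zero j _ = refl
  interior-lead M (suc i) zero _ = refl
  interior-lead M (suc i) (suc j) (inj₁ ())
  interior-lead M (suc i) (suc j) (inj₂ ())

  module ColumnZero {M N : Mat size} (ΛM : InΛ size m M) (ΛN : InΛ size m N)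
                    (leadM : LeadCol M) (M⊆N : interior M ⊆ᶜ N) where

    -- A row i ≥ m of M vanishes in column 0, so it lies inside row i of N.
    far-row : ∀ i → m ≤ toℕ i → M i ≗ N i
    far-row (suc i) m≤i =
      weight-squeeze M⊑N (trans (row-weight ΛM (suc i)) (sym (row-weight ΛN (suc i))))
      where
      M⊑N : M (suc i) ⊑ N (suc i)
      M⊑N zero e =
        ⊥-elim (true≢false (trans (sym e) (trans (lead-col ΛM leadM (suc i)) (lead-false m≤i))))
      M⊑N (suc j) e = M⊆N (suc i) (suc j) e

    -- Hence column 0 of N vanishes beyond row m, and its weight m forces the rest.
    column-zero : ∀ i → N i zero ≡ M i zero
    column-zero i = trans (⊑-lead-exact m≤size (col-weight ΛN zero) N⊑lead i) (sym (lead-col ΛM leadM i))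
      where
      N⊑lead : (λ a → N a zero) ⊑ lead m
      N⊑lead a e with toℕ a <? m
      ... | yes a<m = lead-true a<m
      ... | no a≮m = ⊥-elim (true≢false (trans (sym e) (trans (sym (far-row a (≮⇒≥ a≮m) zero))
                                 (trans (lead-col ΛM leadM a) (lead-false (≮⇒≥ a≮m))))))

  -- The interior 1s define M: first column 0 and row 0 are recovered, and
  -- then every row of M lies inside the corresponding row of N.
  interior-defining : {M : Mat size} → InΛ size m M → LeadCol M → LeadCol (tr M) →
                      IsDefining size m M (interior M)
  interior-defining {M} ΛM leadM leadMᵀ = ΛM , determined
    where
    determined : ∀ N → InΛ size m N → (∀ i j → interior M i j ≡ true → N i j ≡ M i j) →
                 ∀ i j → N i j ≡ M i j
    determined N ΛN agree i j =
      sym (weight-squeeze (M⊑N i) (trans (row-weight ΛM i) (sym (row-weight ΛN i))) j)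
      where
      M⊆N : interior M ⊆ᶜ N
      M⊆N a b e = trans (agree a b e) (interior-⊆ M a b e)
      Mᵀ⊆Nᵀ : interior (tr M) ⊆ᶜ tr N
      Mᵀ⊆Nᵀ a b e = M⊆N b a (trans (sym (interior-tr M a b)) e)
      M⊑N : ∀ i → M i ⊑ N i
      M⊑N zero b e = trans (ColumnZero.column-zero (tr-Λ ΛM) (tr-Λ ΛN) leadMᵀ Mᵀ⊆Nᵀ b) e
      M⊑N (suc a) zero e = trans (ColumnZero.column-zero ΛM ΛN leadM M⊆N (suc a)) e
      M⊑N (suc a) (suc b) e = M⊆N (suc a) (suc b) e

  -- A defining set made of interior 1s contains each 1 at (i, j) with
  -- i ≥ 1 and j ≥ m: row i has a 0 at some column c < m, and the switch on
  -- rows i, 0 and columns j, c has its other three cells outside K.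
  far-column-forced : {M : Mat size} {K : CellSet size} → InΛ size m M → LeadCol (tr M) →
                      IsDefining size m M K → K ⊆ᶜ interior M →
                      ∀ i j → 1 ≤ toℕ i → m ≤ toℕ j → M i j ≡ true → K i j ≡ true
  far-column-forced {M} {K} ΛM leadMᵀ dK K⊆ (suc i) j _ m≤j Mij
    with lead-gap m≤size (row-weight ΛM (suc i)) m≤j Mij
  ... | c , c<m , Mic = switch-forces s dK (⊆-false K⊆M Mic) (⊆-false K⊆ refl) (⊆-false K⊆ refl)
    where
    K⊆M : K ⊆ᶜ M
    K⊆M = ⊆-trans K⊆ (interior-⊆ M)
    s : Switch M
    s = record
      { r₁ = suc i ; r₂ = zero ; c₁ = j ; c₂ = c
      ; r₁≢r₂ = λ ()
      ; c₁≢c₂ = λ { refl → ≤⇒≯ m≤j c<m }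
      ; M₁₁ = Mij
      ; M₁₂ = Mic
      ; M₂₁ = trans (lead-col (tr-Λ ΛM) leadMᵀ j) (lead-false m≤j)
      ; M₂₂ = leadMᵀ c c<m
      }

  far-row-forced : {M : Mat size} {K : CellSet size} → InΛ size m M → LeadCol M →
                   IsDefining size m M K → K ⊆ᶜ interior M →
                   ∀ i j → m ≤ toℕ i → 1 ≤ toℕ j → M i j ≡ true → K i j ≡ true
  far-row-forced {M} {K} ΛM leadM dK K⊆ i j m≤i 1≤j =
    far-column-forced (tr-Λ ΛM) leadM (tr-defining dK) Kᵀ⊆ j i 1≤j m≤i
    where
    Kᵀ⊆ : tr K ⊆ᶜ interior (tr M)
    Kᵀ⊆ a b e = trans (interior-tr M a b) (K⊆ b a e)

lemma20 : (m : ℕ) → 1 ≤ m → (M : Mat (m + m)) → InΛ (m + m) m M →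
    (∀ (i : Fin (m + m)) (j : Fin (m + m)) → toℕ i < m → toℕ j ≡ 0 → M i j ≡ true) →
    (∀ (i : Fin (m + m)) (j : Fin (m + m)) → toℕ i ≡ 0 → toℕ j < m → M i j ≡ true) →
    Σ (CellSet (m + m)) λ K →
      IsCritical (m + m) m M K
      × (∀ i j → (toℕ i ≡ 0 ⊎ toℕ j ≡ 0) → K i j ≡ false)
      × (∀ i j → 1 ≤ toℕ i → 1 ≤ toℕ j → (m ≤ toℕ i ⊎ m ≤ toℕ j) →
           M i j ≡ true → K i j ≡ true)
      × (∀ i j → 1 ≤ toℕ i → 1 ≤ toℕ j → M i j ≡ false → K i j ≡ false)
lemma20 (suc k) _ M ΛM col₀ row₀ = K , critical , avoids-lead , contains-far-ones , avoids-zeros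
  where
  open LeadLines k
  leadM : LeadCol M
  leadM i i<m = col₀ i zero i<m refl
  leadMᵀ : LeadCol (tr M)
  leadMᵀ j j<m = row₀ zero j refl j<m
  minimal : Σ (CellSet size) λ K → K ⊆ᶜ interior M × IsCritical size m M K
  minimal = critical-subset (interior-defining ΛM leadM leadMᵀ)
  K : CellSet size
  K = proj₁ minimal
  K⊆ : K ⊆ᶜ interior M
  K⊆ = proj₁ (proj₂ minimal)
  critical : IsCritical size m M K
  critical = proj₂ (proj₂ minimal)
  avoids-lead : ∀ i j → toℕ i ≡ 0 ⊎ toℕ j ≡ 0 → K i j ≡ false
  avoids-lead i j i∨j≡0 = ⊆-false K⊆ (interior-lead M i j i∨j≡0)
  contains-far-ones : ∀ i j → 1 ≤ toℕ i → 1 ≤ toℕ j → m ≤ toℕ i ⊎ m ≤ toℕ j →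
                      M i j ≡ true → K i j ≡ true
  contains-far-ones i j _ 1≤j (inj₁ m≤i) = far-row-forced ΛM leadM (proj₁ critical) K⊆ i j m≤i 1≤j
  contains-far-ones i j 1≤i _ (inj₂ m≤j) = far-column-forced ΛM leadMᵀ (proj₁ critical) K⊆ i j 1≤i m≤j
  avoids-zeros : ∀ i j → 1 ≤ toℕ i → 1 ≤ toℕ j → M i j ≡ false → K i j ≡ false
  avoids-zeros i j _ _ Mij = ⊆-false (⊆-trans K⊆ (interior-⊆ M)) Mij
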